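{- Let $C_3\in\mathbb{N}_{\ge1}$, $D\in\mathbb{Z}\setminus\{0\}$ with $\gcd(C_3,D)=1$. For every $(a,b)\in\mathbb{N}^2$ with $\gcd(a,b)=1$ and $(u,v)\in\mathbb{Z}^2$ with $\gcd(u,v)=1$ satisfying $au^2-bv^2=\frac{b-a}{C_3}D$, one has $\gcd(u^2,b)\gcd(v^2,a)\mid D$ and $\gcd(u-v,b-a)\mid\frac{b-a}{C_3}$. -}

module Defs where

{-# OPTIONS --safe #-}
module Submission where

-- Let G₁ = gcd(u², b) and G₂ = gcd(v², a). Both divide a u² - b v² = k D, and both are
-- coprime to k: a common divisor of k and of a or b divides b - a = C₃ k, hence both a
-- and b. So G₁ and G₂ divide D, and as divisors of the coprime b and a their product
-- does too. For the second claim, a u² - b v² = a (u - v)(u + v) - (b - a) v² shows that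
-- G = gcd(u - v, b - a) divides D k; it also divides b - a = C₃ k, and gcd(C₃, D) = 1
-- gives G ∣ k.

open import Defs
open import Data.Nat using (ℕ; _≥_)
open import Data.Integer using (ℤ; +_; _+_; _-_; _*_; 0ℤ; 1ℤ)
open import Data.Integer.GCD using (gcd)
open import Data.Integer.Divisibility using (_∣_)
open import Relation.Binary.PropositionalEquality using (_≡_; _≢_)
open import Data.Product using (_×_)

open import Data.Product using (_,_; proj₁; proj₂)
open import Data.Integer using (∣_∣)
open import Data.Integer.Properties using (abs-*; ∣-i∣≡∣i∣; *-comm)
import Data.Integer.GCD as ℤ
open import Data.Integer.Coprimality using (Coprime)
import Data.Integer.Coprimality as ℤ
-- The argument uses signed divisibility, a record whose indices Agda can infer; the
-- unsigned divisibility of the statement is recovered with ∣⇒∣ᵤ at the end.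
open import Data.Integer.Divisibility.Signed
  using (∣ᵤ⇒∣; ∣⇒∣ᵤ; ∣-refl; ∣m∣n⇒∣m-n; ∣m+n∣m⇒∣n; ∣m+n∣n⇒∣m; ∣m⇒∣-m; ∣n⇒∣m*n; ∣m⇒∣m*n)
  renaming (_∣_ to infix 4 _∣ₛ_)
import Data.Nat as ℕ
import Data.Nat.Divisibility as ℕ
import Data.Nat.Coprimality as ℕ
import Data.Nat.Properties as ℕ
open import Data.Integer.Solver using (module +-*-Solver)
open import Relation.Binary.PropositionalEquality using (refl; sym; cong; subst; trans)

gcd[i,j]∣ₛi : ∀ i j → gcd i j ∣ₛ i
gcd[i,j]∣ₛi i j = ∣ᵤ⇒∣ (ℤ.gcd[i,j]∣i i j)

gcd[i,j]∣ₛj : ∀ i j → gcd i j ∣ₛ j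
gcd[i,j]∣ₛj i j = ∣ᵤ⇒∣ (ℤ.gcd[i,j]∣j i j)

gcd≡1⇒coprime : ∀ {i j} → gcd i j ≡ 1ℤ → Coprime i j
gcd≡1⇒coprime gcd≡1 = ℕ.gcd≡1⇒coprime (cong ∣_∣ gcd≡1)

coprime-∣ˡ : ∀ {d i j} → d ∣ₛ i → Coprime i j → Coprime d j
coprime-∣ˡ d∣i i⊥j (e∣d , e∣j) = i⊥j (ℕ.∣-trans e∣d (∣⇒∣ᵤ d∣i) , e∣j)

coprime-∣ʳ : ∀ {d i j} → d ∣ₛ j → Coprime i j → Coprime i d
coprime-∣ʳ {d} {i} {j} d∣j i⊥j = ℤ.sym {d} {i} (coprime-∣ˡ {j = i} d∣j (ℤ.sym {i} {j} i⊥j))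

coprime-divisor : ∀ {i j k} → Coprime i j → i ∣ₛ j * k → i ∣ₛ k
coprime-divisor {i} {j} {k} i⊥j i∣jk = ∣ᵤ⇒∣ (ℤ.coprime-divisor i j k i⊥j (∣⇒∣ᵤ i∣jk))

coprime-factors : ∀ {c d i k} → Coprime c d → i ∣ₛ c * k → i ∣ₛ d * k → i ∣ₛ k
coprime-factors {c} {d} {i} {k} c⊥d i∣ck i∣dk = ∣ᵤ⇒∣ (ℕ.coprime-factors c⊥d
  (subst (∣ i ∣ ℕ.∣_) (abs-* c k) (∣⇒∣ᵤ i∣ck) , subst (∣ i ∣ ℕ.∣_) (abs-* d k) (∣⇒∣ᵤ i∣dk)))

coprime⇒*-∣ : ∀ {i j k} → Coprime i j → i ∣ₛ k → j ∣ₛ k → i * j ∣ₛ k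
coprime⇒*-∣ {i} {j} {k} i⊥j i∣k j∣k =
  ∣ᵤ⇒∣ (subst (ℕ._∣ ∣ k ∣) (sym (abs-* i j)) (ℕ-coprime⇒*-∣ i⊥j (∣⇒∣ᵤ i∣k) (∣⇒∣ᵤ j∣k)))
  where
  ℕ-coprime⇒*-∣ : ∀ {m n x} → ℕ.Coprime m n → m ℕ.∣ x → n ℕ.∣ x → m ℕ.* n ℕ.∣ x
  ℕ-coprime⇒*-∣ {m} {n} m⊥n m∣x (ℕ.divides q refl) =
    ℕ.*-monoˡ-∣ n (ℕ.coprime-divisor m⊥n (subst (m ℕ.∣_) (ℕ.*-comm q n) m∣x))

coprime-∣-difference : ∀ {a b k} → Coprime a b → k ∣ₛ b - a → Coprime a k × Coprime b k
coprime-∣-difference {a} {b} {k} a⊥b k∣b-a = a⊥k , b⊥k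
  where
  ∣b-a : ∀ {d} → d ℕ.∣ ∣ k ∣ → + d ∣ₛ b - a
  ∣b-a d∣k = ∣ᵤ⇒∣ (ℕ.∣-trans d∣k (∣⇒∣ᵤ k∣b-a))

  a⊥k : Coprime a k
  a⊥k {d} (d∣a , d∣k) =
    a⊥b (d∣a , ∣⇒∣ᵤ (∣m+n∣n⇒∣m {+ d} {b} (∣b-a d∣k) (∣m⇒∣-m (∣ᵤ⇒∣ {+ d} {a} d∣a))))

  b⊥k : Coprime b k
  b⊥k {d} (d∣b , d∣k) =
    a⊥b (subst (d ℕ.∣_) (∣-i∣≡∣i∣ a) (∣⇒∣ᵤ (∣m+n∣m⇒∣n (∣b-a d∣k) (∣ᵤ⇒∣ {+ d} {b} d∣b))) , d∣b)

weighted-squares-split : ∀ a b u v →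
  a * (u * u) - b * (v * v) ≡ a * ((u - v) * (u + v)) - (b - a) * (v * v)
weighted-squares-split = solve 4
  (λ a b u v → a :* (u :* u) :- b :* (v :* v) := a :* ((u :- v) :* (u :+ v)) :- (b :- a) :* (v :* v))
  refl
  where open +-*-Solver

gcd[x,b]*gcd[y,a]∣D : ∀ {a b k D} x y → Coprime a b → k ∣ₛ b - a →
  a * x - b * y ≡ k * D → gcd x b * gcd y a ∣ₛ D
gcd[x,b]*gcd[y,a]∣D {a} {b} {k} {D} x y a⊥b k∣b-a ax-by≡kD =
  coprime⇒*-∣ {gcd x b} {gcd y a} G₁⊥G₂ G₁∣D G₂∣D
  where
  G₁∣x : gcd x b ∣ₛ x
  G₁∣x = gcd[i,j]∣ₛi x b
  G₁∣b : gcd x b ∣ₛ b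
  G₁∣b = gcd[i,j]∣ₛj x b
  G₂∣y : gcd y a ∣ₛ y
  G₂∣y = gcd[i,j]∣ₛi y a
  G₂∣a : gcd y a ∣ₛ a
  G₂∣a = gcd[i,j]∣ₛj y a

  G₁⊥G₂ : Coprime (gcd x b) (gcd y a)
  G₁⊥G₂ = coprime-∣ˡ {j = gcd y a} G₁∣b (coprime-∣ʳ {i = b} G₂∣a (ℤ.sym {a} {b} a⊥b))

  G₁∣D : gcd x b ∣ₛ D
  G₁∣D = coprime-divisor {gcd x b} {k}
    (coprime-∣ˡ {j = k} G₁∣b (proj₂ (coprime-∣-difference {a} {b} a⊥b k∣b-a)))
    (subst (gcd x b ∣ₛ_) ax-by≡kD (∣m∣n⇒∣m-n (∣n⇒∣m*n a G₁∣x) (∣m⇒∣m*n y G₁∣b)))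

  G₂∣D : gcd y a ∣ₛ D
  G₂∣D = coprime-divisor {gcd y a} {k}
    (coprime-∣ˡ {j = k} G₂∣a (proj₁ (coprime-∣-difference {a} {b} a⊥b k∣b-a)))
    (subst (gcd y a ∣ₛ_) ax-by≡kD (∣m∣n⇒∣m-n (∣m⇒∣m*n x G₂∣a) (∣n⇒∣m*n b G₂∣y)))

gcd[u-v,b-a]∣k : ∀ {a b c k D} u v → Coprime c D → b - a ≡ c * k →
  a * (u * u) - b * (v * v) ≡ k * D → gcd (u - v) (b - a) ∣ₛ k
gcd[u-v,b-a]∣k {a} {b} {c} {k} {D} u v c⊥D b-a≡ck au²-bv²≡kD =
  coprime-factors {c} {D} c⊥D (subst (G ∣ₛ_) b-a≡ck G∣b-a) G∣Dk
  where
  G : ℤ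
  G = gcd (u - v) (b - a)
  G∣u-v : G ∣ₛ u - v
  G∣u-v = gcd[i,j]∣ₛi (u - v) (b - a)
  G∣b-a : G ∣ₛ b - a
  G∣b-a = gcd[i,j]∣ₛj (u - v) (b - a)

  G∣Dk : G ∣ₛ D * k
  G∣Dk = subst (G ∣ₛ_)
    (trans (sym (weighted-squares-split a b u v)) (trans au²-bv²≡kD (*-comm k D)))
    (∣m∣n⇒∣m-n (∣n⇒∣m*n a (∣m⇒∣m*n (u + v) G∣u-v)) (∣m⇒∣m*n (v * v) G∣b-a))

mainTheorem15 : (C₃ : ℕ) → C₃ ≥ 1 → (D : ℤ) → D ≢ 0ℤ → gcd (+ C₃) D ≡ 1ℤ →
    (a b : ℕ) → gcd (+ a) (+ b) ≡ 1ℤ →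
    (u v : ℤ) → gcd u v ≡ 1ℤ →
    (k : ℤ) → (+ b) - (+ a) ≡ (+ C₃) * k →
    (+ a) * (u * u) - (+ b) * (v * v) ≡ k * D →
    ((gcd (u * u) (+ b) * gcd (v * v) (+ a)) ∣ D)
    × (gcd (u - v) ((+ b) - (+ a)) ∣ k)
mainTheorem15 C₃ _ D _ gcd[C₃,D]≡1 a b gcd[a,b]≡1 u v _ k b-a≡C₃k au²-bv²≡kD =
  ∣⇒∣ᵤ (gcd[x,b]*gcd[y,a]∣D {+ a} {+ b} {k} {D} (u * u) (v * v) a⊥b k∣b-a au²-bv²≡kD) ,
  ∣⇒∣ᵤ (gcd[u-v,b-a]∣k {+ a} {+ b} {+ C₃} {k} {D} u v C₃⊥D b-a≡C₃k au²-bv²≡kD)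
  where
  C₃⊥D : Coprime (+ C₃) D
  C₃⊥D = gcd≡1⇒coprime {+ C₃} {D} gcd[C₃,D]≡1

  a⊥b : Coprime (+ a) (+ b)
  a⊥b = gcd≡1⇒coprime {+ a} {+ b} gcd[a,b]≡1

  k∣b-a : k ∣ₛ + b - + a
  k∣b-a = subst (k ∣ₛ_) (sym b-a≡C₃k) (∣n⇒∣m*n (+ C₃) ∣-refl)
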